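{- For every $n\ge 3$, the number $|A^{132}(n)|$ of alternating permutations $\sigma\in A_n$ with $\sigma_1<\sigma_3<\sigma_2$ (i.e. whose prefix $\sigma_1\sigma_2\sigma_3$ is order-isomorphic to $132$) equals $n!$ times the coefficient of $x^n$ in $(2-x)(\sec x+\tan x)$; that is, $|A^{132}(n)|=2E_n-nE_{n-1}$.
   Context: A permutation $\sigma$ of $\{1,\dots,n\}$ is alternating if $\sigma_1<\sigma_2>\sigma_3<\sigma_4>\cdots$; $A_n$ is the set of such permutations. $E_n$ denotes the $n$-th Euler number, defined by $\sum_{n\ge0}E_n\frac{x^n}{n!}=\sec x+\tan x$. -}

module Defs where

open import Data.Bool using (Bool; true; false; _∧_; not)
open import Data.Nat using (ℕ; zero; suc; _<ᵇ_; _≡ᵇ_)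
open import Data.Nat.Combinatorics using (_C_)
open import Data.Fin using (Fin; toℕ)
open import Data.Integer using (ℤ; +_; -_; _+_; _-_; _*_)
open import Data.List using (List; []; _∷_; [_]; map; concatMap; allFin; filterᵇ; length; downFrom; zipWith; foldr)

-- Permutations of {0,…,n-1} (order-isomorphic to {1,…,n}) as lists.

words : (m k : ℕ) → List (List ℕ)
words m zero    = [ [] ]
words m (suc k) = concatMap (λ i → map (toℕ i ∷_) (words m k)) (allFin m)

notIn : ℕ → List ℕ → Bool
notIn a []       = true
notIn a (b ∷ bs) = not (a ≡ᵇ b) ∧ notIn a bs

distinct : List ℕ → Bool
distinct []       = true
distinct (a ∷ as) = notIn a as ∧ distinct as

perms : ℕ → List (List ℕ)
perms n = filterᵇ distinct (words n n)

mutual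
  altUp : List ℕ → Bool
  altUp (a ∷ b ∷ rest) = (a <ᵇ b) ∧ altDown (b ∷ rest)
  altUp _              = true

  altDown : List ℕ → Bool
  altDown (a ∷ b ∷ rest) = (b <ᵇ a) ∧ altUp (b ∷ rest)
  altDown _              = true

prefix132 : List ℕ → Bool
prefix132 (a ∷ b ∷ c ∷ _) = (a <ᵇ c) ∧ (c <ᵇ b)
prefix132 _               = false

A132count : ℕ → ℕ
A132count n = length (filterᵇ (λ σ → altUp σ ∧ prefix132 σ) (perms n))

-- Euler numbers, via the formal power series identity
--   (sec x + tan x) · cos x = 1 + sin x,
-- compared coefficientwise in exponential form:
--   Σ_{k ≤ n} C(n,k) E_k c_{n-k} = s_n,
-- where c_j = j!·[x^j] cos x and s_n = n!·[x^n] (1 + sin x).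
-- Since c_0 = 1 this determines E_n uniquely from E_0,…,E_{n-1}.

cosC : ℕ → ℤ
cosC 0 = + 1
cosC 1 = + 0
cosC 2 = - (+ 1)
cosC 3 = + 0
cosC (suc (suc (suc (suc j)))) = cosC j

sinC : ℕ → ℤ
sinC 0 = + 0
sinC 1 = + 1
sinC 2 = + 0
sinC 3 = - (+ 1)
sinC (suc (suc (suc (suc j)))) = sinC j

onePlusSinC : ℕ → ℤ
onePlusSinC 0 = + 1
onePlusSinC n = sinC n

-- eulerRev n = [E_{n-1}, …, E_1, E_0]
eulerRev : ℕ → List ℤ
eulerRev zero    = []
eulerRev (suc n) = next ∷ es
  where
  es = eulerRev n
  next = onePlusSinC n
         - foldr _+_ (+ 0) (zipWith (λ k ek → + (n C k) * ek * cosC (Data.Nat._∸_ n k)) (downFrom n) es)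

headOr0 : List ℤ → ℤ
headOr0 []      = + 0
headOr0 (x ∷ _) = x

E : ℕ → ℤ
E n = headOr0 (eulerRev (suc n))

-- Let entringer k j count the ways to extend an alternating word by k letters when k values
-- are still unused and j of them lie on the side required by the next step: nothing else
-- about the word matters. Fixing σ₃ = c (values 0, …, n − 1) leaves c choices for σ₁ < c,
-- n − 1 − c for σ₂ > c and entringer (n − 3) (n − 2 − c) continuations, so
-- |A¹³²(n)| = ∑_c c (n − 1 − c) entringer (n − 3) (n − 2 − c), which summation by parts turns
-- into 2 entringer n n − n entringer (n − 1) (n − 1).
--
-- It remains to show that ℰ n = entringer n n satisfies the recurrence
-- ∑_k C(n, k) ℰ k cos_(n−k) = [xⁿ/n!] (1 + sin x) defining E n. The convolution
-- ∑_k C(J, S − k) ℰ k cos_(S−k) and the Entringer number entringer S (S − J) both satisfy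
-- X J (S + 2) = ℰ (S + 2) − ∑_(r<J) ∑_(i<r) X i S, a discrete form of y'' = −y, and they agree
-- for S ≤ 1 up to sin_S on the diagonal J = S; taking J = S gives the recurrence.

module Submission where

open import Defs
open import Algebra.Core using (Op₂)
open import Algebra.Bundles using (CommutativeSemigroup)
open import Algebra.Structures using (IsCommutativeSemiring)
open import Level using (0ℓ)
open import Data.Bool using (true; false)
open import Data.Nat using (ℕ; zero; suc; _∸_; _≤_; _<_; z≤n; s≤s; _<ᵇ_; _≡ᵇ_)
import Data.Nat as ℕ
import Data.Nat.Properties as ℕ
open import Relation.Binary.PropositionalEquality
  using (_≡_; refl; sym; trans; cong; cong₂; module ≡-Reasoning)

<ᵇ-true : ∀ {m n} → m < n → (m <ᵇ n) ≡ true
<ᵇ-true (s≤s z≤n)       = refl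
<ᵇ-true (s≤s (s≤s m<n)) = <ᵇ-true (s≤s m<n)

<ᵇ-false : ∀ {m n} → n ≤ m → (m <ᵇ n) ≡ false
<ᵇ-false z≤n       = refl
<ᵇ-false (s≤s n≤m) = <ᵇ-false n≤m

<ᵇ≡true⇒< : ∀ {m n} → (m <ᵇ n) ≡ true → m < n
<ᵇ≡true⇒< {zero}  {suc n} _  = s≤s z≤n
<ᵇ≡true⇒< {suc m} {suc n} eq = s≤s (<ᵇ≡true⇒< eq)

≡ᵇ-refl : ∀ n → (n ≡ᵇ n) ≡ true
≡ᵇ-refl zero    = refl
≡ᵇ-refl (suc n) = ≡ᵇ-refl n

≡ᵇ-false-< : ∀ {m n} → m < n → (m ≡ᵇ n) ≡ false
≡ᵇ-false-< {zero}  (s≤s _)   = refl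
≡ᵇ-false-< {suc m} (s≤s m<n) = ≡ᵇ-false-< m<n

≡ᵇ-false-> : ∀ {m n} → n < m → (m ≡ᵇ n) ≡ false
≡ᵇ-false-> {n = zero}  (s≤s _)   = refl
≡ᵇ-false-> {n = suc n} (s≤s n<m) = ≡ᵇ-false-> n<m

≡ᵇ-sym : ∀ m n → (m ≡ᵇ n) ≡ (n ≡ᵇ m)
≡ᵇ-sym zero    zero    = refl
≡ᵇ-sym zero    (suc n) = refl
≡ᵇ-sym (suc m) zero    = refl
≡ᵇ-sym (suc m) (suc n) = ≡ᵇ-sym m n

module FiniteSum {A : Set} {_+_ _*_ : Op₂ A} {0# 1# : A}
                 (isCommutativeSemiring : IsCommutativeSemiring _≡_ _+_ _*_ 0# 1#) where

  open IsCommutativeSemiring isCommutativeSemiring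
    using (+-assoc; +-comm; +-identityˡ; +-identityʳ; distribʳ; zeroˡ; +-isCommutativeSemigroup)

  private
    +-commutativeSemigroup : CommutativeSemigroup 0ℓ 0ℓ
    +-commutativeSemigroup = record { isCommutativeSemigroup = +-isCommutativeSemigroup }

  open import Algebra.Properties.CommutativeSemigroup +-commutativeSemigroup using (interchange)
  open ≡-Reasoning

  ∑ : ℕ → (ℕ → A) → A
  ∑ zero    f = 0#
  ∑ (suc n) f = ∑ n f + f n

  ∑-cong : ∀ n {f g : ℕ → A} → (∀ i → i < n → f i ≡ g i) → ∑ n f ≡ ∑ n g
  ∑-cong zero    f≡g = refl
  ∑-cong (suc n) f≡g = cong₂ _+_ (∑-cong n λ i i<n → f≡g i (ℕ.m<n⇒m<1+n i<n)) (f≡g n ℕ.≤-refl)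

  ∑-ext : ∀ n {f g : ℕ → A} → (∀ i → f i ≡ g i) → ∑ n f ≡ ∑ n g
  ∑-ext n f≡g = ∑-cong n λ i _ → f≡g i

  ∑-vanish : ∀ n {f : ℕ → A} → (∀ i → i < n → f i ≡ 0#) → ∑ n f ≡ 0#
  ∑-vanish n f≡0 = trans (∑-cong n f≡0) (∑-0 n)
    where
    ∑-0 : ∀ n → ∑ n (λ _ → 0#) ≡ 0#
    ∑-0 zero    = refl
    ∑-0 (suc n) = trans (+-identityʳ _) (∑-0 n)

  ∑-distrib-+ : ∀ n (f g : ℕ → A) → ∑ n (λ i → f i + g i) ≡ ∑ n f + ∑ n g
  ∑-distrib-+ zero    f g = sym (+-identityˡ 0#)
  ∑-distrib-+ (suc n) f g =
    trans (cong (_+ (f n + g n)) (∑-distrib-+ n f g)) (interchange _ _ _ _)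

  ∑-split : ∀ m k (f : ℕ → A) → ∑ (m ℕ.+ k) f ≡ ∑ m f + ∑ k (λ i → f (m ℕ.+ i))
  ∑-split m zero    f = trans (cong (λ x → ∑ x f) (ℕ.+-identityʳ m)) (sym (+-identityʳ _))
  ∑-split m (suc k) f = begin
    ∑ (m ℕ.+ suc k) f                                   ≡⟨ cong (λ x → ∑ x f) (ℕ.+-suc m k) ⟩
    ∑ (m ℕ.+ k) f + f (m ℕ.+ k)                         ≡⟨ cong (_+ f (m ℕ.+ k)) (∑-split m k f) ⟩
    (∑ m f + ∑ k (λ i → f (m ℕ.+ i))) + f (m ℕ.+ k)     ≡⟨ +-assoc _ _ _ ⟩
    ∑ m f + ∑ (suc k) (λ i → f (m ℕ.+ i))               ∎

  ∑-head : ∀ n (f : ℕ → A) → ∑ (suc n) f ≡ f 0 + ∑ n (λ i → f (suc i))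
  ∑-head zero    f = trans (+-identityˡ (f 0)) (sym (+-identityʳ (f 0)))
  ∑-head (suc n) f = trans (cong (_+ f (suc n)) (∑-head n f)) (+-assoc _ _ _)

  ∑-reverse : ∀ n (f : ℕ → A) → ∑ n (λ i → f (n ∸ suc i)) ≡ ∑ n f
  ∑-reverse zero    f = refl
  ∑-reverse (suc n) f = begin
    ∑ (suc n) (λ i → f (suc n ∸ suc i))      ≡⟨ ∑-head n _ ⟩
    f n + ∑ n (λ i → f (n ∸ suc i))          ≡⟨ cong (f n +_) (∑-reverse n f) ⟩
    f n + ∑ n f                              ≡⟨ +-comm _ _ ⟩
    ∑ (suc n) f                              ∎

  ∑-comm : ∀ m n (f : ℕ → ℕ → A) → ∑ m (λ i → ∑ n (f i)) ≡ ∑ n (λ j → ∑ m (λ i → f i j))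
  ∑-comm zero    n f = sym (∑-vanish n λ _ _ → refl)
  ∑-comm (suc m) n f = begin
    ∑ m (λ i → ∑ n (f i)) + ∑ n (f m)                  ≡⟨ cong (_+ ∑ n (f m)) (∑-comm m n f) ⟩
    ∑ n (λ j → ∑ m (λ i → f i j)) + ∑ n (f m)          ≡⟨ sym (∑-distrib-+ n _ _) ⟩
    ∑ n (λ j → ∑ (suc m) (λ i → f i j))                ∎

  ∑-distribʳ-* : ∀ n c (f : ℕ → A) → ∑ n (λ i → f i * c) ≡ ∑ n f * c
  ∑-distribʳ-* zero    c f = sym (zeroˡ c)
  ∑-distribʳ-* (suc n) c f =
    trans (cong (_+ (f n * c)) (∑-distribʳ-* n c f)) (sym (distribʳ c _ _))

module NaturalSums where

  open import Data.Bool using (Bool; true; false; _∧_; not; if_then_else_)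
  import Data.Bool.Properties as Bool
  open import Data.Nat using (ℕ; zero; suc; _+_; _*_; _∸_; _≤_; _<_; s≤s; _≡ᵇ_; _<ᵇ_)
  open import Data.Nat.Properties
  open import Data.Nat.Tactic.RingSolver using (solve-∀)
  open import Algebra.Properties.CommutativeSemigroup +-commutativeSemigroup using (interchange; xy∙z≈xz∙y)
  open import Data.Empty using (⊥-elim)
  open import Relation.Binary.Definitions using (tri<; tri≈; tri>)
  open FiniteSum +-*-isCommutativeSemiring
  open ≡-Reasoning

  𝟙 : Bool → ℕ
  𝟙 b = if b then 1 else 0

  𝟙-∧ : ∀ x y → 𝟙 (x ∧ y) ≡ (if y then 𝟙 x else 0)
  𝟙-∧ x true  = cong 𝟙 (Bool.∧-identityʳ x)
  𝟙-∧ x false = cong 𝟙 (Bool.∧-zeroʳ x)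

  if-cong : ∀ b {x y : ℕ} → (b ≡ true → x ≡ y) → (if b then x else 0) ≡ (if b then y else 0)
  if-cong true  x≡y = x≡y refl
  if-cong false _   = refl

  ∑-const : ∀ n c → ∑ n (λ _ → c) ≡ n * c
  ∑-const zero    c = refl
  ∑-const (suc n) c = trans (cong (_+ c) (∑-const n c)) (+-comm (n * c) c)

  ∑-guard : ∀ b n (f : ℕ → ℕ) → ∑ n (λ i → if b then f i else 0) ≡ (if b then ∑ n f else 0)
  ∑-guard true  n f = refl
  ∑-guard false n f = ∑-vanish n λ _ _ → refl

  ∑-split-at : ∀ {p n} (f : ℕ → ℕ) → p ≤ n → ∑ n f ≡ ∑ p f + ∑ (n ∸ p) (λ j → f (p + j))
  ∑-split-at {p} {n} f p≤n = trans (cong (λ x → ∑ x f) (sym (m+[n∸m]≡n p≤n))) (∑-split p (n ∸ p) f)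

  ∑-below : ∀ {p n} (f : ℕ → ℕ) → p ≤ n → ∑ n (λ i → if i <ᵇ p then f i else 0) ≡ ∑ p f
  ∑-below {p} {n} f p≤n = begin
    ∑ n G
      ≡⟨ ∑-split-at G p≤n ⟩
    ∑ p G + ∑ (n ∸ p) (λ j → G (p + j))
      ≡⟨ cong₂ _+_ (∑-cong p λ i i<p → cong (λ b → if b then f i else 0) (<ᵇ-true i<p))
                   (∑-vanish (n ∸ p) λ j _ → cong (λ b → if b then f (p + j) else 0) (<ᵇ-false (m≤m+n p j))) ⟩
    ∑ p f + 0
      ≡⟨ +-identityʳ _ ⟩
    ∑ p f ∎
    where
    G : ℕ → ℕ
    G i = if i <ᵇ p then f i else 0

  ∑-above : ∀ {p n} (f : ℕ → ℕ) → p < n → ∑ (suc p) f + ∑ n (λ i → if p <ᵇ i then f i else 0) ≡ ∑ n f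
  ∑-above {p} {n} f p<n = begin
    ∑ (suc p) f + ∑ n G
      ≡⟨ cong (∑ (suc p) f +_) (∑-split-at G p<n) ⟩
    ∑ (suc p) f + (∑ (suc p) G + ∑ (n ∸ suc p) (λ j → G (suc p + j)))
      ≡⟨ cong (λ x → ∑ (suc p) f + (x + ∑ (n ∸ suc p) (λ j → G (suc p + j))))
           (∑-vanish (suc p) λ i i≤p → cong (λ b → if b then f i else 0) (<ᵇ-false (≤-pred i≤p))) ⟩
    ∑ (suc p) f + ∑ (n ∸ suc p) (λ j → G (suc p + j))
      ≡⟨ cong (∑ (suc p) f +_) (∑-ext (n ∸ suc p) λ j →
           cong (λ b → if b then f (suc p + j) else 0) (<ᵇ-true (s≤s (m≤m+n p j)))) ⟩
    ∑ (suc p) f + ∑ (n ∸ suc p) (λ j → f (suc p + j))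
      ≡⟨ sym (∑-split-at f p<n) ⟩
    ∑ n f ∎
    where
    G : ℕ → ℕ
    G i = if p <ᵇ i then f i else 0

  ∑-above-const : ∀ {p n} x → p < n → ∑ n (λ i → if p <ᵇ i then x else 0) ≡ (n ∸ suc p) * x
  ∑-above-const {p} {n} x p<n = begin
    Y                           ≡⟨ sym (m+n∸m≡n (suc p * x) Y) ⟩
    suc p * x + Y ∸ suc p * x   ≡⟨ cong (_∸ suc p * x) total ⟩
    n * x ∸ suc p * x           ≡⟨ sym (*-distribʳ-∸ x n (suc p)) ⟩
    (n ∸ suc p) * x             ∎
    where
    Y = ∑ n (λ i → if p <ᵇ i then x else 0)
    total : suc p * x + Y ≡ n * x
    total = begin
      suc p * x + Y             ≡⟨ cong (_+ Y) (sym (∑-const (suc p) x)) ⟩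
      ∑ (suc p) (λ _ → x) + Y   ≡⟨ ∑-above (λ _ → x) p<n ⟩
      ∑ n (λ _ → x)             ≡⟨ ∑-const n x ⟩
      n * x                     ∎

  rank : (ℕ → Bool) → ℕ → ℕ
  rank q x = ∑ x (λ a → 𝟙 (q a))

  -- The i < m with q i, in increasing order, have ranks 0, 1, 2, ….
  ∑-ranked : ∀ (q : ℕ → Bool) (g : ℕ → ℕ) m →
    ∑ m (λ i → if q i then g (rank q i) else 0) ≡ ∑ (rank q m) g
  ∑-ranked q g zero    = refl
  ∑-ranked q g (suc m) with q m
  ... | true  = trans (cong (_+ g (rank q m)) (∑-ranked q g m)) (cong (λ x → ∑ x g) (+-comm 1 (rank q m)))
  ... | false = trans (+-identityʳ _)
                  (trans (∑-ranked q g m) (cong (λ x → ∑ x g) (sym (+-identityʳ (rank q m)))))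

  ∑-ranked-above : ∀ (q : ℕ → Bool) (g : ℕ → ℕ) {p n} J → p < n → rank q (suc p) + J ≡ rank q n →
    ∑ n (λ i → if p <ᵇ i then (if q i then g (rank q i) else 0) else 0) ≡ ∑ J (λ r → g (rank q (suc p) + r))
  ∑-ranked-above q g {p} {n} J p<n B+J≡ = +-cancelˡ-≡ (∑ B g) _ _ (begin
    ∑ B g + X                       ≡⟨ cong (_+ X) (sym (∑-ranked q g (suc p))) ⟩
    ∑ (suc p) F + X                 ≡⟨ ∑-above F p<n ⟩
    ∑ n F                           ≡⟨ ∑-ranked q g n ⟩
    ∑ (rank q n) g                  ≡⟨ cong (λ x → ∑ x g) (sym B+J≡) ⟩
    ∑ (B + J) g                     ≡⟨ ∑-split B J g ⟩
    ∑ B g + ∑ J (λ r → g (B + r))   ∎)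
    where
    B = rank q (suc p)
    F : ℕ → ℕ
    F i = if q i then g (rank q i) else 0
    X = ∑ n (λ i → if p <ᵇ i then F i else 0)

  rank-remove : ∀ (q : ℕ → Bool) {i} n → i < n → rank (λ a → not (a ≡ᵇ i) ∧ q a) n + 𝟙 (q i) ≡ rank q n
  rank-remove q {i} (suc m) i<1+m with <-cmp i m
  ... | tri< i<m _ _ rewrite ≡ᵇ-false-> i<m = begin
    ∑ m (λ a → 𝟙 (not (a ≡ᵇ i) ∧ q a)) + 𝟙 (q m) + 𝟙 (q i)   ≡⟨ xy∙z≈xz∙y _ (𝟙 (q m)) (𝟙 (q i)) ⟩
    ∑ m (λ a → 𝟙 (not (a ≡ᵇ i) ∧ q a)) + 𝟙 (q i) + 𝟙 (q m)   ≡⟨ cong (_+ 𝟙 (q m)) (rank-remove q m i<m) ⟩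
    ∑ m (λ a → 𝟙 (q a)) + 𝟙 (q m) ∎
  ... | tri≈ _ refl _ rewrite ≡ᵇ-refl i = cong (_+ 𝟙 (q i)) (trans (+-identityʳ _)
    (∑-cong i λ a a<i → cong (λ b → 𝟙 (not b ∧ q a)) (≡ᵇ-false-< a<i)))
  ... | tri> _ _ m<i = ⊥-elim (<-irrefl refl (≤-trans i<1+m m<i))

  ∑-prefix-sums : ∀ K (g : ℕ → ℕ) → ∑ (suc K) (λ i → ∑ i g) ≡ ∑ K (λ r → (K ∸ r) * g r)
  ∑-prefix-sums zero    g = refl
  ∑-prefix-sums (suc K) g = begin
    ∑ (suc K) (λ i → ∑ i g) + ∑ (suc K) g
      ≡⟨ cong (_+ ∑ (suc K) g) (∑-prefix-sums K g) ⟩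
    ∑ K (λ r → (K ∸ r) * g r) + (∑ K g + g K)
      ≡⟨ sym (+-assoc (∑ K (λ r → (K ∸ r) * g r)) (∑ K g) (g K)) ⟩
    ∑ K (λ r → (K ∸ r) * g r) + ∑ K g + g K
      ≡⟨ cong (_+ g K) (sym (∑-distrib-+ K _ g)) ⟩
    ∑ K (λ r → (K ∸ r) * g r + g r) + g K
      ≡⟨ cong₂ _+_ (∑-cong K λ r r<K → trans (+-comm _ (g r)) (cong (_* g r) (sym (+-∸-assoc 1 (<⇒≤ r<K)))))
                   (sym (trans (cong (_* g K) (m+n∸n≡m 1 K)) (*-identityˡ (g K)))) ⟩
    ∑ K (λ r → (suc K ∸ r) * g r) + (suc K ∸ K) * g K ∎

  module _ (f : ℕ → ℕ) where

    summation-by-parts : ∀ K → ∑ K (λ r → suc r * f r) + ∑ K (λ j → ∑ j f) ≡ K * ∑ K f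
    summation-by-parts zero    = refl
    summation-by-parts (suc K) = begin
      (P + suc K * f K) + (∑ K V + V K)     ≡⟨ interchange P _ _ (V K) ⟩
      (P + ∑ K V) + (suc K * f K + V K)     ≡⟨ cong (_+ (suc K * f K + V K)) (summation-by-parts K) ⟩
      K * V K + (suc K * f K + V K)         ≡⟨ rearrange K (V K) (f K) ⟩
      suc K * (V K + f K)                   ∎
      where
      V : ℕ → ℕ
      V j = ∑ j f
      P = ∑ K (λ r → suc r * f r)
      rearrange : ∀ K v x → K * v + (suc K * x + v) ≡ suc K * (v + x)
      rearrange = solve-∀

    weighted-sum-suc : ∀ K →
      ∑ (2 + K) (λ r → suc r * (suc K ∸ r) * f r)
        ≡ ∑ (suc K) (λ r → suc r * (K ∸ r) * f r) + ∑ (suc K) (λ r → suc r * f r)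
    weighted-sum-suc K = begin
      ∑ (suc K) (λ r → suc r * (suc K ∸ r) * f r) + (2 + K) * (K ∸ K) * f (suc K)
        ≡⟨ cong₂ _+_ (∑-cong (suc K) λ r r≤K → cong (λ x → suc r * x * f r) (+-∸-assoc 1 (≤-pred r≤K)))
                     (cong (λ x → (2 + K) * x * f (suc K)) (n∸n≡0 K)) ⟩
      ∑ (suc K) (λ r → suc r * suc (K ∸ r) * f r) + (2 + K) * 0 * f (suc K)
        ≡⟨ cong₂ _+_ (∑-ext (suc K) λ r → split-suc (suc r) (K ∸ r) (f r))
                     (cong (_* f (suc K)) (*-zeroʳ (2 + K))) ⟩
      ∑ (suc K) (λ r → suc r * (K ∸ r) * f r + suc r * f r) + 0
        ≡⟨ +-identityʳ _ ⟩
      ∑ (suc K) (λ r → suc r * (K ∸ r) * f r + suc r * f r)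
        ≡⟨ ∑-distrib-+ (suc K) _ _ ⟩
      ∑ (suc K) (λ r → suc r * (K ∸ r) * f r) + ∑ (suc K) (λ r → suc r * f r) ∎
      where
      split-suc : ∀ a b c → a * suc b * c ≡ a * b * c + a * c
      split-suc = solve-∀

    weighted-prefix-sums : ∀ K →
      ∑ (suc K) (λ r → suc r * (K ∸ r) * f r) + (2 + K) * ∑ (suc K) (λ j → ∑ j f)
        ≡ 2 * ∑ (suc K) (λ j → suc j * ∑ j f)
    weighted-prefix-sums zero    = refl
    weighted-prefix-sums (suc K) = begin
      W (suc K) + (3 + K) * (∑ (suc K) V + V (suc K))
        ≡⟨ cong (_+ (3 + K) * (∑ (suc K) V + V (suc K))) (weighted-sum-suc K) ⟩
      (W K + P) + (3 + K) * (∑ (suc K) V + V (suc K))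
        ≡⟨ regroup (W K) P (∑ (suc K) V) (V (suc K)) K ⟩
      (W K + (2 + K) * ∑ (suc K) V) + (P + ∑ (suc K) V) + (3 + K) * V (suc K)
        ≡⟨ cong₂ (λ x y → x + y + (3 + K) * V (suc K)) (weighted-prefix-sums K) (summation-by-parts (suc K)) ⟩
      2 * ∑ (suc K) (λ j → suc j * V j) + suc K * V (suc K) + (3 + K) * V (suc K)
        ≡⟨ collect (∑ (suc K) (λ j → suc j * V j)) (V (suc K)) K ⟩
      2 * (∑ (suc K) (λ j → suc j * V j) + (2 + K) * V (suc K)) ∎
      where
      V : ℕ → ℕ
      V j = ∑ j f
      W : ℕ → ℕ
      W K = ∑ (suc K) (λ r → suc r * (K ∸ r) * f r)
      P = ∑ (suc K) (λ r → suc r * f r)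
      regroup : ∀ w p S v K → (w + p) + (3 + K) * (S + v) ≡ (w + (2 + K) * S) + (p + S) + (3 + K) * v
      regroup = solve-∀
      collect : ∀ S v K → 2 * S + suc K * v + (3 + K) * v ≡ 2 * (S + (2 + K) * v)
      collect = solve-∀

module Entringer where

  open import Data.Nat using (ℕ; zero; suc; _+_; _*_; _∸_; _≤_; s≤s)
  open import Data.Nat.Properties
  open FiniteSum +-*-isCommutativeSemiring
  open NaturalSums using (∑-prefix-sums; weighted-prefix-sums)
  open import Algebra.Properties.CommutativeSemigroup +-commutativeSemigroup using (x∙yz≈xz∙y)
  open ≡-Reasoning

  -- For j ≤ k this is the Entringer number E(k, j): taking the r-th admissible value from the
  -- far end leaves k ∸ r admissible values for the following step, which goes the other way.
  entringer : ℕ → ℕ → ℕ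
  entringer zero    j = 1
  entringer (suc k) j = ∑ j (λ r → entringer k (k ∸ r))

  entringer-diagonal : ∀ k → entringer (suc k) (suc k) ≡ ∑ (suc k) (entringer k)
  entringer-diagonal k = ∑-reverse (suc k) (entringer k)

  entringer-complement : ∀ k J → J ≤ suc k →
    entringer (suc k) (suc k ∸ J) + ∑ J (entringer k) ≡ entringer (suc k) (suc k)
  entringer-complement k zero    _         = +-identityʳ _
  entringer-complement k (suc J) (s≤s J≤k) = begin
    entringer (suc k) (k ∸ J) + (∑ J (entringer k) + entringer k J)
      ≡⟨ x∙yz≈xz∙y (entringer (suc k) (k ∸ J)) (∑ J (entringer k)) (entringer k J) ⟩
    entringer (suc k) (k ∸ J) + entringer k J + ∑ J (entringer k)
      ≡⟨ cong (λ x → entringer (suc k) (k ∸ J) + entringer k x + ∑ J (entringer k))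
              (sym (m∸[m∸n]≡n J≤k)) ⟩
    entringer (suc k) (suc (k ∸ J)) + ∑ J (entringer k)
      ≡⟨ cong (λ x → entringer (suc k) x + ∑ J (entringer k)) (sym (+-∸-assoc 1 J≤k)) ⟩
    entringer (suc k) (suc k ∸ J) + ∑ J (entringer k)
      ≡⟨ entringer-complement k J (m≤n⇒m≤1+n J≤k) ⟩
    entringer (suc k) (suc k) ∎

  entringer-weighted-diagonal : ∀ k →
    entringer (2 + k) (2 + k) ≡ ∑ (suc k) (λ j → suc j * entringer k j)
  entringer-weighted-diagonal k = begin
    entringer (2 + k) (2 + k)
      ≡⟨ entringer-diagonal (suc k) ⟩
    ∑ (2 + k) (λ i → ∑ i (λ r → entringer k (k ∸ r)))
      ≡⟨ ∑-prefix-sums (suc k) _ ⟩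
    ∑ (suc k) (λ r → (suc k ∸ r) * entringer k (k ∸ r))
      ≡⟨ ∑-cong (suc k) (λ r r≤k → cong (_* entringer k (k ∸ r)) (+-∸-assoc 1 (≤-pred r≤k))) ⟩
    ∑ (suc k) (λ r → suc (k ∸ r) * entringer k (k ∸ r))
      ≡⟨ ∑-reverse (suc k) (λ j → suc j * entringer k j) ⟩
    ∑ (suc k) (λ j → suc j * entringer k j) ∎

  alternating-132-identity : ∀ s →
    ∑ (3 + s) (λ c → c * (2 + s ∸ c) * entringer s (1 + s ∸ c)) + (3 + s) * entringer (2 + s) (2 + s)
      ≡ 2 * entringer (3 + s) (3 + s)
  alternating-132-identity s = begin
    ∑ (3 + s) (λ c → c * (2 + s ∸ c) * entringer s (1 + s ∸ c)) + (3 + s) * entringer (2 + s) (2 + s)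
      ≡⟨ cong₂ (λ x y → x + (3 + s) * y) (∑-head (2 + s) _) (entringer-diagonal (suc s)) ⟩
    ∑ (2 + s) (λ r → suc r * (1 + s ∸ r) * entringer s (s ∸ r)) + (3 + s) * ∑ (2 + s) (entringer (suc s))
      ≡⟨ weighted-prefix-sums (λ r → entringer s (s ∸ r)) (suc s) ⟩
    2 * ∑ (2 + s) (λ j → suc j * entringer (suc s) j)
      ≡⟨ cong (2 *_) (sym (entringer-weighted-diagonal (suc s))) ⟩
    2 * entringer (3 + s) (3 + s) ∎

module Counting where

  open import Data.Bool using (Bool; true; false; _∧_; not; if_then_else_)
  import Data.Bool.Properties as Bool
  open import Algebra.Solver.CommutativeMonoid Bool.∧-commutativeMonoid using (solve; _⊕_; _⊜_)
  open import Data.Nat using (ℕ; zero; suc; _+_; _*_; _∸_; _≤_; _<_; _≡ᵇ_; _<ᵇ_)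
  open import Data.Nat.Properties
  open import Data.Fin using (Fin; toℕ) renaming (zero to fzero; suc to fsuc)
  open import Data.List using (List; []; _∷_; map; concat; filterᵇ; length; tabulate; _++_)
  open import Data.List.Properties using (map-tabulate)
  open Entringer using (entringer)
  open FiniteSum +-*-isCommutativeSemiring
  open NaturalSums
  open ≡-Reasoning

  count : {A : Set} → (A → Bool) → List A → ℕ
  count p []       = 0
  count p (x ∷ xs) = 𝟙 (p x) + count p xs

  module _ {A : Set} where

    length-filterᵇ : ∀ (p : A → Bool) xs → length (filterᵇ p xs) ≡ count p xs
    length-filterᵇ p []       = refl
    length-filterᵇ p (x ∷ xs) with p x
    ... | true  = cong suc (length-filterᵇ p xs)
    ... | false = length-filterᵇ p xs

    count-filterᵇ : ∀ (p q : A → Bool) xs → count q (filterᵇ p xs) ≡ count (λ x → p x ∧ q x) xs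
    count-filterᵇ p q []       = refl
    count-filterᵇ p q (x ∷ xs) with p x
    ... | true  = cong (𝟙 (q x) +_) (count-filterᵇ p q xs)
    ... | false = count-filterᵇ p q xs

    count-++ : ∀ (p : A → Bool) xs ys → count p (xs ++ ys) ≡ count p xs + count p ys
    count-++ p []       ys = refl
    count-++ p (x ∷ xs) ys = trans (cong (𝟙 (p x) +_) (count-++ p xs ys)) (sym (+-assoc (𝟙 (p x)) _ _))

    count-cong : ∀ {p q : A → Bool} xs → (∀ x → p x ≡ q x) → count p xs ≡ count q xs
    count-cong []       p≡q = refl
    count-cong (x ∷ xs) p≡q = cong₂ (λ b c → 𝟙 b + c) (p≡q x) (count-cong xs p≡q)

    count-guard : ∀ b (q : A → Bool) xs → count (λ x → b ∧ q x) xs ≡ (if b then count q xs else 0)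
    count-guard true  q xs       = refl
    count-guard false q []       = refl
    count-guard false q (x ∷ xs) = count-guard false q xs

    count-concat-tabulate : ∀ (p : A → Bool) m (h : Fin m → List A) (c : ℕ → ℕ) →
      (∀ i → count p (h i) ≡ c (toℕ i)) → count p (concat (tabulate h)) ≡ ∑ m c
    count-concat-tabulate p zero    h c h≡c = refl
    count-concat-tabulate p (suc m) h c h≡c = begin
      count p (h fzero ++ concat (tabulate (λ i → h (fsuc i))))
        ≡⟨ count-++ p (h fzero) _ ⟩
      count p (h fzero) + count p (concat (tabulate (λ i → h (fsuc i))))
        ≡⟨ cong₂ _+_ (h≡c fzero)
                     (count-concat-tabulate p m (λ i → h (fsuc i)) (λ j → c (suc j)) (λ i → h≡c (fsuc i))) ⟩
      c 0 + ∑ m (λ j → c (suc j))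
        ≡⟨ sym (∑-head m c) ⟩
      ∑ (suc m) c ∎

  count-map-∷ : ∀ (p : List ℕ → Bool) i ws → count p (map (i ∷_) ws) ≡ count (λ w → p (i ∷ w)) ws
  count-map-∷ p i []       = refl
  count-map-∷ p i (w ∷ ws) = cong (𝟙 (p (i ∷ w)) +_) (count-map-∷ p i ws)

  count-words : ∀ (p : List ℕ → Bool) n k →
    count p (words n (suc k)) ≡ ∑ n (λ i → count (λ w → p (i ∷ w)) (words n k))
  count-words p n k = begin
    count p (concat (map h (tabulate (λ i → i))))
      ≡⟨ cong (λ ws → count p (concat ws)) (map-tabulate (λ i → i) h) ⟩
    count p (concat (tabulate h))
      ≡⟨ count-concat-tabulate p n h _ (λ i → count-map-∷ p (toℕ i) (words n k)) ⟩
    ∑ n (λ i → count (λ w → p (i ∷ w)) (words n k)) ∎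
    where
    h : Fin n → List (List ℕ)
    h i = map (toℕ i ∷_) (words n k)

  -- A direction d = true means that the next letter must be larger. In continues U p d w,
  -- U lists the letters used so far and p is the last of them.
  admissible : Bool → ℕ → ℕ → Bool
  admissible true  p i = p <ᵇ i
  admissible false p i = i <ᵇ p

  alternatesFrom : Bool → ℕ → List ℕ → Bool
  alternatesFrom true  p w = altUp (p ∷ w)
  alternatesFrom false p w = altDown (p ∷ w)

  continues : List ℕ → ℕ → Bool → List ℕ → Bool
  continues U p d []      = true
  continues U p d (i ∷ w) = admissible d p i ∧ (notIn i U ∧ continues (i ∷ U) i (not d) w)

  avoids : List ℕ → List ℕ → Bool
  avoids U []      = true
  avoids U (x ∷ w) = notIn x U ∧ avoids U w

  avoids-∷ : ∀ i U w → avoids (i ∷ U) w ≡ notIn i w ∧ avoids U w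
  avoids-∷ i U []      = refl
  avoids-∷ i U (x ∷ w) = begin
    (not (x ≡ᵇ i) ∧ notIn x U) ∧ avoids (i ∷ U) w
      ≡⟨ cong₂ (λ b c → (not b ∧ notIn x U) ∧ c) (≡ᵇ-sym x i) (avoids-∷ i U w) ⟩
    (not (i ≡ᵇ x) ∧ notIn x U) ∧ (notIn i w ∧ avoids U w)
      ≡⟨ solve 4 (λ a b c d → (a ⊕ b) ⊕ (c ⊕ d) ⊜ (a ⊕ c) ⊕ (b ⊕ d)) refl
               (not (i ≡ᵇ x)) (notIn x U) (notIn i w) (avoids U w) ⟩
    (not (i ≡ᵇ x) ∧ notIn i w) ∧ (notIn x U ∧ avoids U w) ∎

  continues-spec : ∀ U p d w → continues U p d w ≡ (avoids U w ∧ distinct w) ∧ alternatesFrom d p w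
  continues-spec U p true  []      = refl
  continues-spec U p false []      = refl
  continues-spec U p d     (i ∷ w) = begin
    s ∧ (u ∧ continues (i ∷ U) i (not d) w)
      ≡⟨ cong (λ x → s ∧ (u ∧ x)) (continues-spec (i ∷ U) i (not d) w) ⟩
    s ∧ (u ∧ ((avoids (i ∷ U) w ∧ distinct w) ∧ alternatesFrom (not d) i w))
      ≡⟨ cong (λ x → s ∧ (u ∧ ((x ∧ distinct w) ∧ alternatesFrom (not d) i w))) (avoids-∷ i U w) ⟩
    s ∧ (u ∧ (((notIn i w ∧ avoids U w) ∧ distinct w) ∧ alternatesFrom (not d) i w))
      ≡⟨ solve 6 (λ s u n a δ t → s ⊕ (u ⊕ (((n ⊕ a) ⊕ δ) ⊕ t)) ⊜ ((u ⊕ a) ⊕ (n ⊕ δ)) ⊕ (s ⊕ t)) refl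
               s u (notIn i w) (avoids U w) (distinct w) (alternatesFrom (not d) i w) ⟩
    ((u ∧ avoids U w) ∧ (notIn i w ∧ distinct w)) ∧ (s ∧ alternatesFrom (not d) i w)
      ≡⟨ cong (((u ∧ avoids U w) ∧ (notIn i w ∧ distinct w)) ∧_) (alternatesFrom-∷ d) ⟩
    (avoids U (i ∷ w) ∧ distinct (i ∷ w)) ∧ alternatesFrom d p (i ∷ w) ∎
    where
    s = admissible d p i
    u = notIn i U
    alternatesFrom-∷ : ∀ d → admissible d p i ∧ alternatesFrom (not d) i w ≡ alternatesFrom d p (i ∷ w)
    alternatesFrom-∷ true  = refl
    alternatesFrom-∷ false = refl

  distinct-altUp : ∀ a w → distinct (a ∷ w) ∧ altUp (a ∷ w) ≡ continues (a ∷ []) a true w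
  distinct-altUp a w = begin
    (notIn a w ∧ distinct w) ∧ altUp (a ∷ w)
      ≡⟨ cong (λ x → (x ∧ distinct w) ∧ altUp (a ∷ w)) (sym avoids-[a]) ⟩
    (avoids (a ∷ []) w ∧ distinct w) ∧ altUp (a ∷ w)
      ≡⟨ sym (continues-spec (a ∷ []) a true w) ⟩
    continues (a ∷ []) a true w ∎
    where
    avoids-[] : ∀ w → avoids [] w ≡ true
    avoids-[] []      = refl
    avoids-[] (x ∷ w) = avoids-[] w
    avoids-[a] : avoids (a ∷ []) w ≡ notIn a w
    avoids-[a] = trans (avoids-∷ a [] w) (trans (cong (notIn a w ∧_) (avoids-[] w)) (Bool.∧-identityʳ _))

  module Standardization (n : ℕ) where

    completions : List ℕ → ℕ → Bool → ℕ → ℕ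
    completions U p d k = count (continues U p d) (words n k)

    free : List ℕ → ℕ → Bool
    free U a = notIn a U

    nFree : List ℕ → ℕ
    nFree U = rank (free U) n

    nChoices : Bool → List ℕ → ℕ → ℕ
    nChoices d U p = rank (λ a → free U a ∧ admissible d p a) n

    completions-suc : ∀ U p d k → completions U p d (suc k) ≡
      ∑ n (λ i → if admissible d p i then (if free U i then completions (i ∷ U) i (not d) k else 0) else 0)
    completions-suc U p d k = trans (count-words (continues U p d) n k) (∑-ext n λ i →
      trans (count-guard (admissible d p i) _ (words n k))
            (cong (λ x → if admissible d p i then x else 0) (count-guard (free U i) _ (words n k))))

    nChoices-down : ∀ U {p} → p ≤ n → nChoices false U p ≡ rank (free U) p
    nChoices-down U {p} p≤n =
      trans (∑-ext n λ a → 𝟙-∧ (free U a) (a <ᵇ p)) (∑-below (λ a → 𝟙 (free U a)) p≤n)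

    rank+nChoices-up : ∀ U {p} → p < n → rank (free U) (suc p) + nChoices true U p ≡ nFree U
    rank+nChoices-up U {p} p<n =
      trans (cong (rank (free U) (suc p) +_) (∑-ext n λ a → 𝟙-∧ (free U a) (p <ᵇ a)))
            (∑-above (λ a → 𝟙 (free U a)) p<n)

    nChoices-self : ∀ d U i → nChoices d (i ∷ U) i ≡ nChoices d U i
    nChoices-self d U i = ∑-ext n λ a → cong 𝟙 (drop-self a (admissible d i a) refl)
      where
      distinct-from-i : ∀ d a → admissible d i a ≡ true → (a ≡ᵇ i) ≡ false
      distinct-from-i true  a i<a = ≡ᵇ-false-> (<ᵇ≡true⇒< {i} {a} i<a)
      distinct-from-i false a a<i = ≡ᵇ-false-< (<ᵇ≡true⇒< {a} {i} a<i)
      drop-self : ∀ a b → admissible d i a ≡ b → (not (a ≡ᵇ i) ∧ free U a) ∧ b ≡ free U a ∧ b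
      drop-self a true  ok rewrite distinct-from-i d a ok = refl
      drop-self a false _  = trans (Bool.∧-zeroʳ _) (sym (Bool.∧-zeroʳ _))

    nChoices-∷ : ∀ d U p {i} → i < n → nChoices d (i ∷ U) p + 𝟙 (free U i ∧ admissible d p i) ≡ nChoices d U p
    nChoices-∷ d U p i<n =
      trans (cong (_+ _) (∑-ext n λ a →
               cong 𝟙 (Bool.∧-assoc (not (a ≡ᵇ _)) (free U a) (admissible d p a))))
            (rank-remove (λ a → free U a ∧ admissible d p a) n i<n)

    nFree-∷ : ∀ U {i} → i < n → free U i ≡ true → suc (nFree (i ∷ U)) ≡ nFree U
    nFree-∷ U {i} i<n i-free = begin
      suc (nFree (i ∷ U))                   ≡⟨ +-comm 1 (nFree (i ∷ U)) ⟩
      nFree (i ∷ U) + 1                     ≡⟨ cong (λ b → nFree (i ∷ U) + 𝟙 b) (sym i-free) ⟩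
      nFree (i ∷ U) + 𝟙 (free U i)         ≡⟨ rank-remove (free U) n i<n ⟩
      nFree U ∎

    descent-sum : ∀ k U p → p < n → nFree U ≡ suc k →
      ∑ n (λ i → if i <ᵇ p then (if free U i then entringer k (nChoices true U i) else 0) else 0)
        ≡ entringer (suc k) (nChoices false U p)
    descent-sum k U p p<n free≡ = begin
      ∑ n (λ i → if i <ᵇ p then (if free U i then entringer k (nChoices true U i) else 0) else 0)
        ≡⟨ ∑-cong n (λ i i<n → cong (λ x → if i <ᵇ p then x else 0)
             (if-cong (free U i) λ i-free → cong (entringer k) (ascending-choices i<n i-free))) ⟩
      ∑ n (λ i → if i <ᵇ p then (if free U i then entringer k (k ∸ rank (free U) i) else 0) else 0)
        ≡⟨ ∑-below _ (<⇒≤ p<n) ⟩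
      ∑ p (λ i → if free U i then entringer k (k ∸ rank (free U) i) else 0)
        ≡⟨ ∑-ranked (free U) (λ t → entringer k (k ∸ t)) p ⟩
      entringer (suc k) (rank (free U) p)
        ≡⟨ cong (entringer (suc k)) (sym (nChoices-down U (<⇒≤ p<n))) ⟩
      entringer (suc k) (nChoices false U p) ∎
      where
      ascending-choices : ∀ {i} → i < n → free U i ≡ true → nChoices true U i ≡ k ∸ rank (free U) i
      ascending-choices {i} i<n i-free = begin
        nChoices true U i                                  ≡⟨ sym (m+n∸m≡n (suc r) _) ⟩
        suc r + nChoices true U i ∸ suc r                  ≡⟨ cong (λ x → x + nChoices true U i ∸ suc r) rank-suc ⟩
        rank (free U) (suc i) + nChoices true U i ∸ suc r
          ≡⟨ cong (_∸ suc r) (trans (rank+nChoices-up U i<n) free≡) ⟩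
        k ∸ r                                              ∎
        where
        r = rank (free U) i
        rank-suc : suc r ≡ rank (free U) (suc i)
        rank-suc = trans (+-comm 1 r) (cong (λ b → r + 𝟙 b) (sym i-free))

    ascent-sum : ∀ k U p → p < n → nFree U ≡ suc k →
      ∑ n (λ i → if p <ᵇ i then (if free U i then entringer k (nChoices false U i) else 0) else 0)
        ≡ entringer (suc k) (nChoices true U p)
    ascent-sum k U p p<n free≡ = begin
      ∑ n (λ i → if p <ᵇ i then (if free U i then entringer k (nChoices false U i) else 0) else 0)
        ≡⟨ ∑-cong n (λ i i<n → cong (λ x → if p <ᵇ i then x else 0)
             (cong (λ x → if free U i then entringer k x else 0) (nChoices-down U (<⇒≤ i<n)))) ⟩
      ∑ n (λ i → if p <ᵇ i then (if free U i then entringer k (rank (free U) i) else 0) else 0)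
        ≡⟨ ∑-ranked-above (free U) (entringer k) J p<n (rank+nChoices-up U p<n) ⟩
      ∑ J (λ r → entringer k (B + r))
        ≡⟨ sym (∑-reverse J (λ r → entringer k (B + r))) ⟩
      ∑ J (λ r → entringer k (B + (J ∸ suc r)))
        ≡⟨ ∑-cong J (λ r r<J →
             cong (entringer k) (trans (sym (+-∸-assoc B r<J)) (cong (_∸ suc r) B+J≡1+k))) ⟩
      entringer (suc k) J ∎
      where
      B = rank (free U) (suc p)
      J = nChoices true U p
      B+J≡1+k : B + J ≡ suc k
      B+J≡1+k = trans (rank+nChoices-up U p<n) free≡

    completions≡entringer : ∀ k U p d → p < n → nFree U ≡ k → completions U p d k ≡ entringer k (nChoices d U p)
    completions≡entringer zero    U p d _   _     = refl
    completions≡entringer (suc k) U p d p<n free≡ = begin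
      completions U p d (suc k)
        ≡⟨ completions-suc U p d k ⟩
      ∑ n (λ i → if admissible d p i then (if free U i then completions (i ∷ U) i (not d) k else 0) else 0)
        ≡⟨ ∑-cong n (λ i i<n →
             cong (λ x → if admissible d p i then x else 0) (if-cong (free U i) (extend i<n))) ⟩
      ∑ n (λ i → if admissible d p i then (if free U i then entringer k (nChoices (not d) U i) else 0) else 0)
        ≡⟨ next-value d ⟩
      entringer (suc k) (nChoices d U p) ∎
      where
      extend : ∀ {i} → i < n → free U i ≡ true →
        completions (i ∷ U) i (not d) k ≡ entringer k (nChoices (not d) U i)
      extend {i} i<n i-free = trans
        (completions≡entringer k (i ∷ U) i (not d) i<n (suc-injective (trans (nFree-∷ U i<n i-free) free≡)))
        (cong (entringer k) (nChoices-self (not d) U i))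
      next-value : ∀ d →
        ∑ n (λ i → if admissible d p i then (if free U i then entringer k (nChoices (not d) U i) else 0) else 0)
          ≡ entringer (suc k) (nChoices d U p)
      next-value true  = ascent-sum k U p p<n free≡
      next-value false = descent-sum k U p p<n free≡

  module Alternating132 (s : ℕ) where

    N : ℕ
    N = 3 + s

    open Standardization N

    guard-collapse : ∀ a b c C →
      ((a <ᵇ b) ∧ (notIn b (a ∷ []) ∧ ((c <ᵇ b) ∧ (notIn c (b ∷ a ∷ []) ∧ C)))) ∧ ((a <ᵇ c) ∧ (c <ᵇ b))
        ≡ ((a <ᵇ c) ∧ (c <ᵇ b)) ∧ C
    guard-collapse a b c C with a <ᵇ c in a<ᵇc | c <ᵇ b in c<ᵇb
    ... | true  | true  = ordered (<ᵇ≡true⇒< a<ᵇc) (<ᵇ≡true⇒< c<ᵇb)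
      where
      ordered : a < c → c < b →
        ((a <ᵇ b) ∧ (notIn b (a ∷ []) ∧ (true ∧ (notIn c (b ∷ a ∷ []) ∧ C)))) ∧ true ≡ true ∧ C
      ordered a<c c<b rewrite <ᵇ-true (<-trans a<c c<b) | ≡ᵇ-false-> {b} {a} (<-trans a<c c<b)
                            | ≡ᵇ-false-< {c} {b} c<b | ≡ᵇ-false-> {c} {a} a<c = Bool.∧-identityʳ C
    ... | true  | false = Bool.∧-zeroʳ _
    ... | false | _     = Bool.∧-zeroʳ _

    prefix-condition : ∀ a b c w →
      distinct (a ∷ b ∷ c ∷ w) ∧ (altUp (a ∷ b ∷ c ∷ w) ∧ prefix132 (a ∷ b ∷ c ∷ w))
        ≡ ((a <ᵇ c) ∧ (c <ᵇ b)) ∧ continues (c ∷ b ∷ a ∷ []) c true w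
    prefix-condition a b c w = begin
      distinct σ ∧ (altUp σ ∧ prefix132 σ)     ≡⟨ sym (Bool.∧-assoc (distinct σ) (altUp σ) (prefix132 σ)) ⟩
      (distinct σ ∧ altUp σ) ∧ prefix132 σ     ≡⟨ cong (_∧ prefix132 σ) (distinct-altUp a (b ∷ c ∷ w)) ⟩
      continues (a ∷ []) a true (b ∷ c ∷ w) ∧ prefix132 σ
                                               ≡⟨ guard-collapse a b c _ ⟩
      ((a <ᵇ c) ∧ (c <ᵇ b)) ∧ continues (c ∷ b ∷ a ∷ []) c true w ∎
      where
      σ = a ∷ b ∷ c ∷ w

    completions-132 : ∀ {a b c} → a < c → c < b → b < N →
      completions (c ∷ b ∷ a ∷ []) c true s ≡ entringer s (N ∸ (2 + c))
    completions-132 {a} {b} {c} a<c c<b b<N =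
      trans (completions≡entringer s (c ∷ b ∷ a ∷ []) c true c<N free-count) (cong (entringer s) nChoices-count)
      where
      c<N = <-trans c<b b<N
      a<N = <-trans a<c c<N
      c-free : free (b ∷ a ∷ []) c ≡ true
      c-free rewrite ≡ᵇ-false-< {c} {b} c<b | ≡ᵇ-false-> {c} {a} a<c = refl
      b-free : free (a ∷ []) b ≡ true
      b-free rewrite ≡ᵇ-false-> {b} {a} (<-trans a<c c<b) = refl
      nFree-[] : nFree [] ≡ N
      nFree-[] = trans (∑-const N 1) (*-identityʳ N)
      free-count : nFree (c ∷ b ∷ a ∷ []) ≡ s
      free-count = suc-injective (suc-injective (suc-injective (begin
        3 + nFree (c ∷ b ∷ a ∷ [])   ≡⟨ cong (2 +_) (nFree-∷ (b ∷ a ∷ []) c<N c-free) ⟩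
        2 + nFree (b ∷ a ∷ [])       ≡⟨ cong (1 +_) (nFree-∷ (a ∷ []) b<N b-free) ⟩
        1 + nFree (a ∷ [])           ≡⟨ nFree-∷ [] a<N refl ⟩
        nFree []                     ≡⟨ nFree-[] ⟩
        N                            ∎)))
      nChoices-count : nChoices true (c ∷ b ∷ a ∷ []) c ≡ N ∸ (2 + c)
      nChoices-count = suc-injective (begin
        suc (nChoices true (c ∷ b ∷ a ∷ []) c)   ≡⟨ cong suc (nChoices-self true (b ∷ a ∷ []) c) ⟩
        suc (nChoices true (b ∷ a ∷ []) c)       ≡⟨ +-comm 1 _ ⟩
        nChoices true (b ∷ a ∷ []) c + 1         ≡⟨ remove-b ⟩
        nChoices true (a ∷ []) c                 ≡⟨ remove-a ⟩
        nChoices true [] c                       ≡⟨ trans (∑-above-const 1 c<N) (*-identityʳ _) ⟩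
        N ∸ suc c                                ≡⟨ +-∸-assoc 1 (≤-pred (≤-trans c<b (≤-pred b<N))) ⟩
        suc (N ∸ (2 + c))                        ∎)
        where
        remove-b : nChoices true (b ∷ a ∷ []) c + 1 ≡ nChoices true (a ∷ []) c
        remove-b = trans (cong (λ x → nChoices true (b ∷ a ∷ []) c + 𝟙 x)
                               (sym (cong₂ _∧_ b-free (<ᵇ-true c<b))))
                         (nChoices-∷ true (a ∷ []) c b<N)
        remove-a : nChoices true (a ∷ []) c ≡ nChoices true [] c
        remove-a = trans (sym (+-identityʳ _))
                   (trans (cong (λ x → nChoices true (a ∷ []) c + 𝟙 x) (sym (<ᵇ-false (<⇒≤ a<c))))
                          (nChoices-∷ true [] c a<N))

    count-pairs : ∀ {c} → c < N → ∀ X →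
      ∑ N (λ a → ∑ N (λ b → if (a <ᵇ c) ∧ (c <ᵇ b) then X else 0)) ≡ c * (N ∸ suc c) * X
    count-pairs {c} c<N X = begin
      ∑ N (λ a → ∑ N (λ b → if (a <ᵇ c) ∧ (c <ᵇ b) then X else 0))
        ≡⟨ ∑-ext N (λ a → trans (∑-ext N λ b → Bool.if-∧ (a <ᵇ c)) (∑-guard (a <ᵇ c) N _)) ⟩
      ∑ N (λ a → if a <ᵇ c then Y else 0)      ≡⟨ ∑-below (λ _ → Y) (<⇒≤ c<N) ⟩
      ∑ c (λ _ → Y)                             ≡⟨ ∑-const c Y ⟩
      c * Y                                     ≡⟨ cong (c *_) (∑-above-const X c<N) ⟩
      c * ((N ∸ suc c) * X)                     ≡⟨ sym (*-assoc c _ X) ⟩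
      c * (N ∸ suc c) * X                       ∎
      where
      Y = ∑ N (λ b → if c <ᵇ b then X else 0)

    A132count-formula : A132count N ≡ ∑ N (λ c → c * (N ∸ suc c) * entringer s (N ∸ (2 + c)))
    A132count-formula = begin
      A132count N
        ≡⟨ length-filterᵇ _ (perms N) ⟩
      count (λ σ → altUp σ ∧ prefix132 σ) (filterᵇ distinct (words N N))
        ≡⟨ count-filterᵇ distinct _ (words N N) ⟩
      count R (words N (3 + s))
        ≡⟨ trans (count-words R N (2 + s)) (∑-ext N λ a →
             trans (count-words _ N (suc s)) (∑-ext N λ b → count-words _ N s)) ⟩
      ∑ N (λ a → ∑ N (λ b → ∑ N (λ c → count (λ w → R (a ∷ b ∷ c ∷ w)) (words N s))))
        ≡⟨ ∑-ext N (λ a → ∑-ext N λ b → ∑-ext N λ c →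
             trans (count-cong (words N s) (prefix-condition a b c)) (count-guard _ _ (words N s))) ⟩
      ∑ N (λ a → ∑ N (λ b → ∑ N (λ c →
        if (a <ᵇ c) ∧ (c <ᵇ b) then completions (c ∷ b ∷ a ∷ []) c true s else 0)))
        ≡⟨ ∑-ext N (λ a → ∑-cong N λ b b<N → ∑-ext N λ c → if-cong ((a <ᵇ c) ∧ (c <ᵇ b)) λ guard →
             completions-132 (<ᵇ≡true⇒< (Bool.∧-conicalˡ (a <ᵇ c) (c <ᵇ b) guard))
                             (<ᵇ≡true⇒< (Bool.∧-conicalʳ (a <ᵇ c) (c <ᵇ b) guard)) b<N) ⟩
      ∑ N (λ a → ∑ N (λ b → ∑ N (λ c → T a b c)))
        ≡⟨ trans (∑-ext N λ a → ∑-comm N N (T a)) (∑-comm N N _) ⟩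
      ∑ N (λ c → ∑ N (λ a → ∑ N (λ b → T a b c)))
        ≡⟨ ∑-cong N (λ c c<N → count-pairs c<N (entringer s (N ∸ (2 + c)))) ⟩
      ∑ N (λ c → c * (N ∸ suc c) * entringer s (N ∸ (2 + c))) ∎
      where
      R : List ℕ → Bool
      R σ = distinct σ ∧ (altUp σ ∧ prefix132 σ)
      T : ℕ → ℕ → ℕ → ℕ
      T a b c = if (a <ᵇ c) ∧ (c <ᵇ b) then entringer s (N ∸ (2 + c)) else 0

module EulerNumbers where

  open import Data.Bool using (if_then_else_)
  open import Data.Nat.Combinatorics using (_C_; nCk+nC[k+1]≡[n+1]C[k+1]; nCk≡nC[n∸k])
  open import Data.Integer using (ℤ; +_; -_; _+_; _-_; _*_; 0ℤ)
  import Data.Integer.Properties as ℤ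
  open import Data.Integer.Tactic.RingSolver using (solve-∀)
  open import Data.List using (_∷_; map; downFrom; zipWith; foldr)
  open import Data.Sum using (inj₁; inj₂)
  open import Relation.Binary.Definitions using (tri<; tri≈; tri>)
  open Entringer using (entringer; entringer-complement)
  module ℕΣ = FiniteSum ℕ.+-*-isCommutativeSemiring
  open ℕΣ using (∑)
  open FiniteSum ℤ.+-*-isCommutativeSemiring renaming (∑ to ∑ℤ)
  open ≡-Reasoning

  ∑-choose : ∀ J m → ∑ J (λ r → r C m) ≡ J C suc m
  ∑-choose zero    m = refl
  ∑-choose (suc J) m = begin
    ∑ J (λ r → r C m) ℕ.+ J C m   ≡⟨ cong (ℕ._+ J C m) (∑-choose J m) ⟩
    J C suc m ℕ.+ J C m           ≡⟨ ℕ.+-comm (J C suc m) (J C m) ⟩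
    J C m ℕ.+ J C suc m           ≡⟨ nCk+nC[k+1]≡[n+1]C[k+1] J m ⟩
    suc J C suc m                 ∎

  pos-∑ : ∀ n (f : ℕ → ℕ) → + ∑ n f ≡ ∑ℤ n (λ i → + f i)
  pos-∑ zero    f = refl
  pos-∑ (suc n) f = trans (ℤ.pos-+ (∑ n f) (f n)) (cong (_+ + f n) (pos-∑ n f))

  ∑-neg : ∀ n (f : ℕ → ℤ) → ∑ℤ n (λ i → - f i) ≡ - ∑ℤ n f
  ∑-neg zero    f = refl
  ∑-neg (suc n) f = trans (cong (_+ - f n) (∑-neg n f)) (sym (ℤ.neg-distrib-+ (∑ℤ n f) (f n)))

  ∑-indicator : ∀ i n (x : ℤ) → ∑ℤ n (λ a → if a ≡ᵇ i then x else 0ℤ) ≡ (if i <ᵇ n then x else 0ℤ)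
  ∑-indicator i zero    x = refl
  ∑-indicator i (suc n) x with ℕ.<-cmp i n
  ... | tri< i<n _ _ rewrite ∑-indicator i n x | <ᵇ-true i<n | ≡ᵇ-false-> i<n
                           | <ᵇ-true (ℕ.m<n⇒m<1+n i<n) = ℤ.+-identityʳ x
  ... | tri≈ _ refl _ rewrite ∑-indicator i i x | <ᵇ-false (ℕ.≤-refl {i}) | ≡ᵇ-refl i
                           | <ᵇ-true (ℕ.n<1+n i) = ℤ.+-identityˡ x
  ... | tri> _ _ n<i rewrite ∑-indicator i n x | <ᵇ-false (ℕ.<⇒≤ n<i) | ≡ᵇ-false-< n<i
                           | <ᵇ-false n<i = refl

  ∑∑ : ℕ → (ℕ → ℤ) → ℤ
  ∑∑ J g = ∑ℤ J (λ r → ∑ℤ r g)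

  ∑∑-cong : ∀ J {f g : ℕ → ℤ} → (∀ i → 2 ℕ.+ i ≤ J → f i ≡ g i) → ∑∑ J f ≡ ∑∑ J g
  ∑∑-cong J f≡g = ∑-cong J λ r r<J → ∑-cong r λ i i<r → f≡g i (ℕ.≤-trans (s≤s i<r) r<J)

  pos-∑∑ : ∀ J (f : ℕ → ℕ) → + ∑ J (λ r → ∑ r f) ≡ ∑∑ J (λ i → + f i)
  pos-∑∑ J f = trans (pos-∑ J _) (∑-ext J λ r → pos-∑ r f)

  ∑∑-choose : ∀ J m → ∑ J (λ r → ∑ r (λ i → i C m)) ≡ J C (2 ℕ.+ m)
  ∑∑-choose J m = trans (ℕΣ.∑-ext J λ r → ∑-choose r m) (∑-choose J (suc m))

  cosC-+2 : ∀ m → cosC (2 ℕ.+ m) ≡ - cosC m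
  cosC-+2 0 = refl
  cosC-+2 1 = refl
  cosC-+2 2 = refl
  cosC-+2 3 = refl
  cosC-+2 (suc (suc (suc (suc m)))) = cosC-+2 m

  sinC-+2 : ∀ m → sinC (2 ℕ.+ m) ≡ - sinC m
  sinC-+2 0 = refl
  sinC-+2 1 = refl
  sinC-+2 2 = refl
  sinC-+2 3 = refl
  sinC-+2 (suc (suc (suc (suc m)))) = sinC-+2 m

  ℰ : ℕ → ℤ
  ℰ k = + entringer k k

  -- At J = S this is the left-hand side of the recurrence defining E, as C(S, S ∸ k) = C(S, k).
  cosConvolution : ℕ → ℕ → ℤ
  cosConvolution J S = ∑ℤ (suc S) (λ k → + (J C (S ∸ k)) * ℰ k * cosC (S ∸ k))

  ∑∑-cosConvolution : ∀ J S →
    ∑∑ J (λ i → cosConvolution i S) ≡ ∑ℤ (suc S) (λ k → + (J C (2 ℕ.+ (S ∸ k))) * ℰ k * cosC (S ∸ k))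
  ∑∑-cosConvolution J S = begin
    ∑ℤ J (λ r → ∑ℤ r (λ i → ∑ℤ (suc S) (F i)))
      ≡⟨ ∑-ext J (λ r → ∑-comm r (suc S) F) ⟩
    ∑ℤ J (λ r → ∑ℤ (suc S) (λ k → ∑ℤ r (λ i → F i k)))
      ≡⟨ ∑-comm J (suc S) _ ⟩
    ∑ℤ (suc S) (λ k → ∑∑ J (λ i → F i k))
      ≡⟨ ∑-ext (suc S) collapse ⟩
    ∑ℤ (suc S) (λ k → + (J C (2 ℕ.+ (S ∸ k))) * ℰ k * cosC (S ∸ k)) ∎
    where
    F : ℕ → ℕ → ℤ
    F i k = + (i C (S ∸ k)) * ℰ k * cosC (S ∸ k)
    collapse : ∀ k → ∑∑ J (λ i → F i k) ≡ + (J C (2 ℕ.+ (S ∸ k))) * ℰ k * cosC (S ∸ k)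
    collapse k = begin
      ∑∑ J (λ i → + (i C (S ∸ k)) * ℰ k * cosC (S ∸ k))
        ≡⟨ ∑-ext J (λ r → ∑-ext r λ i → ℤ.*-assoc (+ (i C (S ∸ k))) (ℰ k) (cosC (S ∸ k))) ⟩
      ∑∑ J (λ i → + (i C (S ∸ k)) * X)
        ≡⟨ ∑-ext J (λ r → ∑-distribʳ-* r X _) ⟩
      ∑ℤ J (λ r → ∑ℤ r (λ i → + (i C (S ∸ k))) * X)
        ≡⟨ ∑-distribʳ-* J X _ ⟩
      ∑∑ J (λ i → + (i C (S ∸ k))) * X
        ≡⟨ cong (_* X) (sym (pos-∑∑ J (λ i → i C (S ∸ k)))) ⟩
      + ∑ J (λ r → ∑ r (λ i → i C (S ∸ k))) * X
        ≡⟨ cong (λ x → + x * X) (∑∑-choose J (S ∸ k)) ⟩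
      + (J C (2 ℕ.+ (S ∸ k))) * X
        ≡⟨ sym (ℤ.*-assoc (+ (J C (2 ℕ.+ (S ∸ k)))) (ℰ k) (cosC (S ∸ k))) ⟩
      + (J C (2 ℕ.+ (S ∸ k))) * ℰ k * cosC (S ∸ k) ∎
      where
      X = ℰ k * cosC (S ∸ k)

  cosConvolution-step : ∀ J S → cosConvolution J (2 ℕ.+ S) ≡ ℰ (2 ℕ.+ S) - ∑∑ J (λ i → cosConvolution i S)
  cosConvolution-step J S = begin
    (∑ℤ (suc S) h + h (suc S)) + h (2 ℕ.+ S)
      ≡⟨ cong₂ (λ x y → (x + y) + h (2 ℕ.+ S)) (∑-cong (suc S) λ k k≤S → shifted k (ℕ.≤-pred k≤S)) vanishing ⟩
    (∑ℤ (suc S) (λ k → - G k) + 0ℤ) + h (2 ℕ.+ S)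
      ≡⟨ cong₂ (λ x y → (x + 0ℤ) + y) (∑-neg (suc S) G) leading ⟩
    (- ∑ℤ (suc S) G + 0ℤ) + ℰ (2 ℕ.+ S)
      ≡⟨ rearrange (∑ℤ (suc S) G) (ℰ (2 ℕ.+ S)) ⟩
    ℰ (2 ℕ.+ S) - ∑ℤ (suc S) G
      ≡⟨ cong (λ x → ℰ (2 ℕ.+ S) - x) (sym (∑∑-cosConvolution J S)) ⟩
    ℰ (2 ℕ.+ S) - ∑∑ J (λ i → cosConvolution i S) ∎
    where
    h : ℕ → ℤ
    h k = + (J C (2 ℕ.+ S ∸ k)) * ℰ k * cosC (2 ℕ.+ S ∸ k)
    G : ℕ → ℤ
    G k = + (J C (2 ℕ.+ (S ∸ k))) * ℰ k * cosC (S ∸ k)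
    shifted : ∀ k → k ≤ S → h k ≡ - G k
    shifted k k≤S = begin
      h k
        ≡⟨ cong (λ x → + (J C x) * ℰ k * cosC x) (ℕ.+-∸-assoc 2 k≤S) ⟩
      + (J C (2 ℕ.+ (S ∸ k))) * ℰ k * cosC (2 ℕ.+ (S ∸ k))
        ≡⟨ cong (+ (J C (2 ℕ.+ (S ∸ k))) * ℰ k *_) (cosC-+2 (S ∸ k)) ⟩
      + (J C (2 ℕ.+ (S ∸ k))) * ℰ k * - cosC (S ∸ k)
        ≡⟨ sym (ℤ.neg-distribʳ-* (+ (J C (2 ℕ.+ (S ∸ k))) * ℰ k) (cosC (S ∸ k))) ⟩
      - G k ∎
    vanishing : h (suc S) ≡ 0ℤ
    vanishing = trans (cong (λ x → + (J C x) * ℰ (suc S) * cosC x) (ℕ.m+n∸n≡m 1 S))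
                      (ℤ.*-zeroʳ (+ (J C 1) * ℰ (suc S)))
    leading : h (2 ℕ.+ S) ≡ ℰ (2 ℕ.+ S)
    leading = trans (cong (λ x → + (J C x) * ℰ (2 ℕ.+ S) * cosC x) (ℕ.n∸n≡0 (2 ℕ.+ S)))
                    (unit (ℰ (2 ℕ.+ S)))
      where
      unit : ∀ e → + 1 * e * + 1 ≡ e
      unit = solve-∀
    rearrange : ∀ g e → (- g + 0ℤ) + e ≡ e - g
    rearrange = solve-∀

  entringer-step : ∀ J S → J ≤ 2 ℕ.+ S →
    + entringer (2 ℕ.+ S) (2 ℕ.+ S ∸ J) ≡ ℰ (2 ℕ.+ S) - ∑∑ J (λ i → + entringer S (S ∸ i))
  entringer-step J S J≤ = begin
    + entringer (2 ℕ.+ S) (2 ℕ.+ S ∸ J)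
      ≡⟨ cancel (+ entringer (2 ℕ.+ S) (2 ℕ.+ S ∸ J)) (+ ∑ J (entringer (suc S))) ⟩
    (+ entringer (2 ℕ.+ S) (2 ℕ.+ S ∸ J) + + ∑ J (entringer (suc S))) - + ∑ J (entringer (suc S))
      ≡⟨ cong₂ _-_ (trans (sym (ℤ.pos-+ (entringer (2 ℕ.+ S) (2 ℕ.+ S ∸ J)) _))
                          (cong +_ (entringer-complement (suc S) J J≤)))
                   (pos-∑∑ J (λ i → entringer S (S ∸ i))) ⟩
    ℰ (2 ℕ.+ S) - ∑∑ J (λ i → + entringer S (S ∸ i)) ∎
    where
    cancel : ∀ a b → a ≡ (a + b) - b
    cancel = solve-∀

  diagonalSin : ℕ → ℕ → ℤ
  diagonalSin J S = if J ≡ᵇ S then sinC S else 0ℤ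

  ∑-beyond : ∀ S J (x : ℤ) → J ≤ 2 ℕ.+ S →
    ∑ℤ J (λ r → if S <ᵇ r then x else 0ℤ) ≡ (if J ≡ᵇ 2 ℕ.+ S then x else 0ℤ)
  ∑-beyond S J x J≤ with ℕ.m≤n⇒m<n∨m≡n J≤
  ... | inj₂ refl rewrite ≡ᵇ-refl S | <ᵇ-true (ℕ.n<1+n S) =
    trans (cong (_+ x) (∑-vanish (suc S) λ r r≤S →
                          cong (λ b → if b then x else 0ℤ) (<ᵇ-false (ℕ.≤-pred r≤S))))
          (ℤ.+-identityˡ x)
  ... | inj₁ J<2+S rewrite ≡ᵇ-false-< J<2+S =
    ∑-vanish J λ r r<J →
      cong (λ b → if b then x else 0ℤ) (<ᵇ-false (ℕ.≤-pred (ℕ.≤-trans r<J (ℕ.≤-pred J<2+S))))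

  ∑∑-diagonalSin : ∀ J S → J ≤ 2 ℕ.+ S → ∑∑ J (λ i → diagonalSin i S) ≡ - diagonalSin J (2 ℕ.+ S)
  ∑∑-diagonalSin J S J≤ = begin
    ∑∑ J (λ i → diagonalSin i S)                       ≡⟨ ∑-ext J (λ r → ∑-indicator S r (sinC S)) ⟩
    ∑ℤ J (λ r → if S <ᵇ r then sinC S else 0ℤ)         ≡⟨ ∑-beyond S J (sinC S) J≤ ⟩
    (if J ≡ᵇ 2 ℕ.+ S then sinC S else 0ℤ)             ≡⟨ negate-branch (J ≡ᵇ 2 ℕ.+ S) ⟩
    - diagonalSin J (2 ℕ.+ S)                          ∎
    where
    negate-branch : ∀ b → (if b then sinC S else 0ℤ) ≡ - (if b then sinC (2 ℕ.+ S) else 0ℤ)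
    negate-branch true  = trans (sym (ℤ.neg-involutive (sinC S))) (cong -_ (sym (sinC-+2 S)))
    negate-branch false = refl

  cosConvolution≡entringer : ∀ S J → J ≤ S → cosConvolution J S ≡ + entringer S (S ∸ J) + diagonalSin J S
  cosConvolution≡entringer zero          zero       _ = refl
  cosConvolution≡entringer (suc zero)    zero       _ = refl
  cosConvolution≡entringer (suc zero)    (suc zero) _ = refl
  cosConvolution≡entringer (suc zero)    (suc (suc _)) (s≤s ())
  cosConvolution≡entringer (suc (suc S)) J          J≤ = begin
    cosConvolution J (2 ℕ.+ S)
      ≡⟨ cosConvolution-step J S ⟩
    ℰ (2 ℕ.+ S) - ∑∑ J (λ i → cosConvolution i S)
      ≡⟨ cong (λ x → ℰ (2 ℕ.+ S) - x) (∑∑-cong J λ i 2+i≤J →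
           cosConvolution≡entringer S i (ℕ.≤-pred (ℕ.≤-pred (ℕ.≤-trans 2+i≤J J≤)))) ⟩
    ℰ (2 ℕ.+ S) - ∑∑ J (λ i → + entringer S (S ∸ i) + diagonalSin i S)
      ≡⟨ cong (λ x → ℰ (2 ℕ.+ S) - x)
           (trans (∑-ext J λ r → ∑-distrib-+ r _ _) (∑-distrib-+ J _ _)) ⟩
    ℰ (2 ℕ.+ S) - (∑∑ J (λ i → + entringer S (S ∸ i)) + ∑∑ J (λ i → diagonalSin i S))
      ≡⟨ regroup (ℰ (2 ℕ.+ S)) (∑∑ J (λ i → + entringer S (S ∸ i))) (∑∑ J (λ i → diagonalSin i S)) ⟩
    (ℰ (2 ℕ.+ S) - ∑∑ J (λ i → + entringer S (S ∸ i))) + - ∑∑ J (λ i → diagonalSin i S)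
      ≡⟨ cong₂ (λ x y → x + - y) (sym (entringer-step J S J≤)) (∑∑-diagonalSin J S J≤) ⟩
    + entringer (2 ℕ.+ S) (2 ℕ.+ S ∸ J) + - - diagonalSin J (2 ℕ.+ S)
      ≡⟨ cong (λ x → + entringer (2 ℕ.+ S) (2 ℕ.+ S ∸ J) + x)
              (ℤ.neg-involutive (diagonalSin J (2 ℕ.+ S))) ⟩
    + entringer (2 ℕ.+ S) (2 ℕ.+ S ∸ J) + diagonalSin J (2 ℕ.+ S) ∎
    where
    regroup : ∀ e a d → e - (a + d) ≡ (e - a) + - d
    regroup = solve-∀

  cosConvolution-diagonal : ∀ n → cosConvolution n n ≡ onePlusSinC n
  cosConvolution-diagonal n = begin
    cosConvolution n n
      ≡⟨ cosConvolution≡entringer n n ℕ.≤-refl ⟩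
    + entringer n (n ∸ n) + diagonalSin n n
      ≡⟨ cong₂ (λ j b → + entringer n j + (if b then sinC n else 0ℤ)) (ℕ.n∸n≡0 n) (≡ᵇ-refl n) ⟩
    + entringer n 0 + sinC n
      ≡⟨ corner n ⟩
    onePlusSinC n ∎
    where
    corner : ∀ n → + entringer n 0 + sinC n ≡ onePlusSinC n
    corner zero    = refl
    corner (suc n) = ℤ.+-identityˡ (sinC (suc n))

  ℰ-recurrence : ∀ n → ∑ℤ n (λ k → + (n C k) * ℰ k * cosC (n ∸ k)) + ℰ n ≡ onePlusSinC n
  ℰ-recurrence n = begin
    ∑ℤ n (λ k → + (n C k) * ℰ k * cosC (n ∸ k)) + ℰ n
      ≡⟨ cong₂ _+_ (∑-cong n λ k k<n → cong (λ x → + x * ℰ k * cosC (n ∸ k)) (nCk≡nC[n∸k] (ℕ.<⇒≤ k<n)))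
                   (sym last-term) ⟩
    cosConvolution n n
      ≡⟨ cosConvolution-diagonal n ⟩
    onePlusSinC n ∎
    where
    unit : ∀ e → + 1 * e * + 1 ≡ e
    unit = solve-∀
    last-term : + (n C (n ∸ n)) * ℰ n * cosC (n ∸ n) ≡ ℰ n
    last-term = trans (cong (λ x → + (n C x) * ℰ n * cosC x) (ℕ.n∸n≡0 n)) (unit (ℰ n))

  foldr-zipWith-downFrom : ∀ (g : ℕ → ℤ → ℤ) (e : ℕ → ℤ) m →
    foldr _+_ 0ℤ (zipWith g (downFrom m) (map e (downFrom m))) ≡ ∑ℤ m (λ k → g k (e k))
  foldr-zipWith-downFrom g e zero    = refl
  foldr-zipWith-downFrom g e (suc m) =
    trans (cong (λ x → g m (e m) + x) (foldr-zipWith-downFrom g e m)) (ℤ.+-comm (g m (e m)) _)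

  eulerRev≡ℰ : ∀ n → eulerRev n ≡ map ℰ (downFrom n)
  eulerRev≡ℰ zero    = refl
  eulerRev≡ℰ (suc n) = cong₂ _∷_ head-term (eulerRev≡ℰ n)
    where
    term : ℕ → ℤ → ℤ
    term k ek = + (n C k) * ek * cosC (n ∸ k)
    solve-for : ∀ s e o → s + e ≡ o → o - s ≡ e
    solve-for s e o s+e≡o = trans (cong (_- s) (sym s+e≡o)) (cancel s e)
      where
      cancel : ∀ s e → (s + e) - s ≡ e
      cancel = solve-∀
    head-term : onePlusSinC n - foldr _+_ 0ℤ (zipWith term (downFrom n) (eulerRev n)) ≡ ℰ n
    head-term = begin
      onePlusSinC n - foldr _+_ 0ℤ (zipWith term (downFrom n) (eulerRev n))
        ≡⟨ cong (λ es → onePlusSinC n - foldr _+_ 0ℤ (zipWith term (downFrom n) es)) (eulerRev≡ℰ n) ⟩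
      onePlusSinC n - foldr _+_ 0ℤ (zipWith term (downFrom n) (map ℰ (downFrom n)))
        ≡⟨ cong (λ x → onePlusSinC n - x) (foldr-zipWith-downFrom term ℰ n) ⟩
      onePlusSinC n - ∑ℤ n (λ k → term k (ℰ k))
        ≡⟨ solve-for _ (ℰ n) (onePlusSinC n) (ℰ-recurrence n) ⟩
      ℰ n ∎

  E≡ℰ : ∀ n → E n ≡ ℰ n
  E≡ℰ n = cong headOr0 (eulerRev≡ℰ (suc n))

open import Data.Integer using (ℤ; +_; _+_; _-_; _*_)
import Data.Integer.Properties as ℤ
open import Data.Integer.Tactic.RingSolver using (solve-∀)
open Entringer using (entringer; alternating-132-identity)
open EulerNumbers using (ℰ; E≡ℰ)
open Counting using (module Alternating132)

A132count-identity : ∀ s → let n = 3 ℕ.+ s in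
  A132count n ℕ.+ n ℕ.* entringer (n ∸ 1) (n ∸ 1) ≡ 2 ℕ.* entringer n n
A132count-identity s =
  trans (cong (ℕ._+ (3 ℕ.+ s) ℕ.* entringer (2 ℕ.+ s) (2 ℕ.+ s)) (Alternating132.A132count-formula s))
        (alternating-132-identity s)

pos-isolate : ∀ a m x k y → a ℕ.+ m ℕ.* x ≡ k ℕ.* y → + a ≡ + k * + y - + m * + x
pos-isolate a m x k y eq = begin
  + a                             ≡⟨ cancel (+ a) (+ m * + x) ⟩
  (+ a + + m * + x) - + m * + x   ≡⟨ cong (λ z → z - + m * + x) lift ⟩
  + k * + y - + m * + x           ∎
  where
  open ≡-Reasoning
  cancel : ∀ a b → a ≡ (a + b) - b
  cancel = solve-∀
  lift : + a + + m * + x ≡ + k * + y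
  lift = begin
    + a + + m * + x      ≡⟨ cong (λ z → + a + z) (sym (ℤ.pos-* m x)) ⟩
    + a + + (m ℕ.* x)    ≡⟨ sym (ℤ.pos-+ a (m ℕ.* x)) ⟩
    + (a ℕ.+ m ℕ.* x)    ≡⟨ cong +_ eq ⟩
    + (k ℕ.* y)          ≡⟨ ℤ.pos-* k y ⟩
    + k * + y            ∎

mainTheorem4 : (n : ℕ) → 3 ≤ n → + (A132count n) ≡ (+ 2) * E n - (+ n) * E (n ∸ 1)
mainTheorem4 n@(suc (suc (suc s))) (s≤s (s≤s (s≤s z≤n))) = begin
  + A132count n
    ≡⟨ pos-isolate (A132count n) n (entringer (n ∸ 1) (n ∸ 1)) 2 (entringer n n) (A132count-identity s) ⟩
  + 2 * ℰ n - + n * ℰ (n ∸ 1)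
    ≡⟨ sym (cong₂ (λ e e′ → + 2 * e - + n * e′) (E≡ℰ n) (E≡ℰ (n ∸ 1))) ⟩
  + 2 * E n - + n * E (n ∸ 1) ∎
  where open ≡-Reasoning
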